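{- Let $\mathbf{A}$ be a Stonean residuated lattice. Then for every $x\in A$, $x=\neg\neg x\ast(\neg\neg x\to x)$.
   Context: A residuated lattice is an algebra $(A,\ast,\to,\vee,\wedge,\top)$ with $(A,\ast,\top)$ a commutative monoid, $(A,\vee,\wedge)$ a lattice with top $\top$, and $x\ast y\le z$ iff $x\le y\to z$. A bounded residuated lattice also has a constant $\bot$ which is the least element; $\neg x:=x\to\bot$. A Stonean residuated lattice is a bounded residuated lattice satisfying $\neg x\vee\neg\neg x=\top$. -}

module Defs where

open import Level using (Level; _⊔_; suc)
open import Relation.Binary.Core using (Rel)
open import Algebra.Core using (Op₂)
open import Algebra.Definitions using (Congruent₂)
open import Algebra.Structures using (IsCommutativeMonoid)
open import Algebra.Lattice.Structures using (IsLattice)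
open import Data.Product using (_×_)

record BoundedResiduatedLattice (c ℓ : Level) : Set (suc (c ⊔ ℓ)) where
  infixr 5 _⇒_
  infixl 7 _*_
  infixr 6 _∨_
  infixr 7 _∧_
  infix  4 _≈_ _≤_
  field
    Carrier : Set c
    _≈_     : Rel Carrier ℓ
    _*_     : Op₂ Carrier
    _⇒_     : Op₂ Carrier
    _∨_     : Op₂ Carrier
    _∧_     : Op₂ Carrier
    ⊤       : Carrier
    ⊥       : Carrier

  _≤_ : Rel Carrier ℓ
  x ≤ y = (x ∧ y) ≈ x

  field
    *-isCommutativeMonoid : IsCommutativeMonoid _≈_ _*_ ⊤
    isLattice             : IsLattice _≈_ _∨_ _∧_
    ⇒-cong                : Congruent₂ _≈_ _⇒_
    ⊤-maximum             : ∀ x → x ≤ ⊤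
    ⊥-minimum             : ∀ x → ⊥ ≤ x
    residuated            : ∀ x y z → ((x * y ≤ z) → (x ≤ y ⇒ z)) × ((x ≤ y ⇒ z) → (x * y ≤ z))

  ¬_ : Carrier → Carrier
  ¬ x = x ⇒ ⊥

record StoneanResiduatedLattice (c ℓ : Level) : Set (suc (c ⊔ ℓ)) where
  field
    boundedResiduatedLattice : BoundedResiduatedLattice c ℓ
  open BoundedResiduatedLattice boundedResiduatedLattice public
  field
    stonean : ∀ x → ((¬ x) ∨ (¬ (¬ x))) ≈ ⊤

-- Since ¬x ∨ ¬¬x = ⊤ and x * ¬x ≤ ⊥, multiplying x by ⊤ = ¬x ∨ ¬¬x shows
-- x ≤ x * ¬¬x. As x ≤ ¬¬x ⇒ x always holds, this gives x ≤ ¬¬x * (¬¬x ⇒ x);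
-- the converse inequality is modus ponens.
module Submission where

open import Defs
open import Data.Product using (proj₁; proj₂)
open import Function.Base using (_∘_)
open import Algebra.Structures using (IsCommutativeMonoid)
open import Algebra.Lattice.Bundles using (Lattice)
import Algebra.Lattice.Properties.Lattice as LatticeProperties
import Relation.Binary.Lattice.Bundles as Order
import Relation.Binary.Reasoning.PartialOrder as ≤-Reasoning
open import Relation.Binary.Bundles using (Poset)

module BoundedResiduatedLatticeProperties
  {c ℓ} (A : BoundedResiduatedLattice c ℓ) where

  open BoundedResiduatedLattice A
    hiding (_≤_; ⊤-maximum; ⊥-minimum; residuated)
  open IsCommutativeMonoid *-isCommutativeMonoid using (comm; identityʳ)

  lattice : Lattice c ℓ
  lattice = record { isLattice = isLattice }

  open Lattice lattice public using (sym)

  -- The record orders by x ∧ y ≈ x; the library's order on a lattice is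
  -- x ≈ x ∧ y, so the record's axioms are transported along sym.
  open Order.Lattice (LatticeProperties.∨-∧-orderTheoreticLattice lattice)
    public using (_≤_; poset; ∨-least)
  open Order.Lattice (LatticeProperties.∨-∧-orderTheoreticLattice lattice)
    using (refl; trans; ≤-respˡ-≈)
  open ≤-Reasoning poset

  ⊤-maximum : ∀ x → x ≤ ⊤
  ⊤-maximum = sym ∘ BoundedResiduatedLattice.⊤-maximum A

  ⊥-minimum : ∀ x → ⊥ ≤ x
  ⊥-minimum = sym ∘ BoundedResiduatedLattice.⊥-minimum A

  residuated⁺ : ∀ {x y z} → x * y ≤ z → x ≤ y ⇒ z
  residuated⁺ {x} {y} {z} =
    sym ∘ proj₁ (BoundedResiduatedLattice.residuated A x y z) ∘ sym

  residuated⁻ : ∀ {x y z} → x ≤ y ⇒ z → x * y ≤ z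
  residuated⁻ {x} {y} {z} =
    sym ∘ proj₂ (BoundedResiduatedLattice.residuated A x y z) ∘ sym

  *-monoˡ-≤ : ∀ {x y} z → x ≤ y → x * z ≤ y * z
  *-monoˡ-≤ {x} {y} z x≤y = residuated⁻ (trans x≤y (residuated⁺ refl))

  *-monoʳ-≤ : ∀ {x y} z → x ≤ y → z * x ≤ z * y
  *-monoʳ-≤ {x} {y} z x≤y = begin
    z * x ≈⟨ comm z x ⟩
    x * z ≤⟨ *-monoˡ-≤ z x≤y ⟩
    y * z ≈⟨ comm y z ⟩
    z * y ∎

  ⇒-modusPonens : ∀ x y → x * (x ⇒ y) ≤ y
  ⇒-modusPonens x y = ≤-respˡ-≈ (comm (x ⇒ y) x) (residuated⁻ refl)

  x*¬x≤⊥ : ∀ x → x * ¬ x ≤ ⊥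
  x*¬x≤⊥ x = ⇒-modusPonens x ⊥

  ∨-*-least : ∀ {x y z w} → x * z ≤ w → y * z ≤ w → (x ∨ y) * z ≤ w
  ∨-*-least x*z≤w y*z≤w =
    residuated⁻ (∨-least (residuated⁺ x*z≤w) (residuated⁺ y*z≤w))

  x≤y⇒x : ∀ x y → x ≤ y ⇒ x
  x≤y⇒x x y = residuated⁺ (begin
    x * y ≤⟨ *-monoʳ-≤ x (⊤-maximum y) ⟩
    x * ⊤ ≈⟨ identityʳ x ⟩
    x     ∎)

module StoneanResiduatedLatticeProperties
  {c ℓ} (A : StoneanResiduatedLattice c ℓ) where

  open StoneanResiduatedLattice A hiding (_≤_; ⊤-maximum; ⊥-minimum; residuated)
  open BoundedResiduatedLatticeProperties boundedResiduatedLattice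
  open IsCommutativeMonoid *-isCommutativeMonoid
    using (comm; identityʳ) renaming (∙-congˡ to *-congˡ)
  open Poset poset using (reflexive)
  open ≤-Reasoning poset

  x≤x*¬¬x : ∀ x → x ≤ x * ¬ ¬ x
  x≤x*¬¬x x = begin
    x                   ≈⟨ sym (identityʳ x) ⟩
    x * ⊤               ≈⟨ *-congˡ (sym (stonean x)) ⟩
    x * (¬ x ∨ ¬ ¬ x)   ≈⟨ comm x _ ⟩
    (¬ x ∨ ¬ ¬ x) * x   ≤⟨ ∨-*-least ¬x*x≤x*¬¬x (reflexive (comm (¬ ¬ x) x)) ⟩
    x * ¬ ¬ x           ∎
    where
    ¬x*x≤x*¬¬x : ¬ x * x ≤ x * ¬ ¬ x
    ¬x*x≤x*¬¬x = begin
      ¬ x * x   ≈⟨ comm (¬ x) x ⟩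
      x * ¬ x   ≤⟨ x*¬x≤⊥ x ⟩
      ⊥         ≤⟨ ⊥-minimum _ ⟩
      x * ¬ ¬ x ∎

  x≤¬¬x*[¬¬x⇒x] : ∀ x → x ≤ ¬ ¬ x * (¬ ¬ x ⇒ x)
  x≤¬¬x*[¬¬x⇒x] x = begin
    x                   ≤⟨ x≤x*¬¬x x ⟩
    x * ¬ ¬ x           ≤⟨ *-monoˡ-≤ (¬ ¬ x) (x≤y⇒x x (¬ ¬ x)) ⟩
    (¬ ¬ x ⇒ x) * ¬ ¬ x ≈⟨ comm _ _ ⟩
    ¬ ¬ x * (¬ ¬ x ⇒ x) ∎

lemma3p2 : ∀ {c ℓ} (A : StoneanResiduatedLattice c ℓ) →
    let open StoneanResiduatedLattice A in
    ∀ (x : Carrier) → x ≈ ((¬ (¬ x)) * ((¬ (¬ x)) ⇒ x))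
lemma3p2 A x = antisym (x≤¬¬x*[¬¬x⇒x] x) (⇒-modusPonens (¬ ¬ x) x)
  where
  open StoneanResiduatedLattice A using (boundedResiduatedLattice; ¬_)
  open BoundedResiduatedLatticeProperties boundedResiduatedLattice
  open StoneanResiduatedLatticeProperties A
  open Poset poset using (antisym)
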